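{- For all $n\ge 4$, $\beta(P_{2\infty}\Box K_n)=n-1$, and $S=\{(0,0),(1,1),\dots,(n-2,n-2)\}$ is a metric basis of $P_{2\infty}\Box K_n$.
   Context: $P_{2\infty}$ has vertex set $\mathbb{Z}$ with $i,j$ adjacent iff $|i-j|=1$. $K_n$ is the complete graph on vertex set $\{0,1,\dots,n-1\}$. Vertices of $P_{2\infty}\Box K_n$ are written $(i,j)$ with $i\in\mathbb{Z}$, $j\in\{0,\dots,n-1\}$. The cartesian product $G\Box H$ has vertex set $V(G)\times V(H)$, with $(a,v)$ adjacent to $(b,w)$ iff either $a=b$ and $vw\in E(H)$, or $v=w$ and $ab\in E(G)$. $d$ is the shortest-path distance. A vertex $x$ resolves $u,v$ if $d(u,x)\neq d(v,x)$; a set $S$ is a resolving set if every pair of distinct vertices is resolved by some vertex of $S$; a metric basis is a resolving set of minimum cardinality and $\beta$ (metric dimension) is its cardinality (infinite if no finite resolving set exists). -}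

module Defs where

open import Data.Nat using (ℕ; zero; suc; _≤_; _∸_)
open import Data.Integer using (ℤ; +_; _-_; ∣_∣)
open import Data.Fin using (Fin; toℕ; inject₁)
open import Data.List using (List; []; map; length; allFin)
open import Data.List.Membership.Propositional using (_∈_)
open import Data.List.Relation.Unary.Unique.Propositional using (Unique)
open import Data.Sum using (_⊎_)
open import Data.Product using (_×_; _,_; Σ; ∃; ∃-syntax)
open import Relation.Binary.PropositionalEquality using (_≡_; _≢_)

record Graph : Set₁ where
  field
    V   : Set
    Adj : V → V → Set
open Graph public

P2∞ : Graph
P2∞ = record { V = ℤ ; Adj = λ i j → ∣ i - j ∣ ≡ 1 }

K : ℕ → Graph
K n = record { V = Fin n ; Adj = λ v w → v ≢ w }

_□_ : Graph → Graph → Graph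
G □ H = record
  { V   = V G × V H
  ; Adj = λ { (a , v) (b , w) → (a ≡ b × Adj H v w) ⊎ (v ≡ w × Adj G a b) } }

data Walk (G : Graph) : V G → V G → ℕ → Set where
  nil : ∀ {u} → Walk G u u zero
  step : ∀ {u w v k} → Adj G u w → Walk G w v k → Walk G u v (suc k)

IsDist : (G : Graph) → V G → V G → ℕ → Set
IsDist G u v k = Walk G u v k × (∀ m → Walk G u v m → k ≤ m)

Resolves : (G : Graph) → V G → V G → V G → Set
Resolves G x u v = ∃[ k₁ ] ∃[ k₂ ] (IsDist G u x k₁ × IsDist G v x k₂ × k₁ ≢ k₂)

IsResolvingSet : (G : Graph) → List (V G) → Set
IsResolvingSet G S = ∀ u v → u ≢ v → ∃[ x ] (x ∈ S × Resolves G x u v)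

IsMetricBasisOfSize : (G : Graph) → List (V G) → ℕ → Set
IsMetricBasisOfSize G S b =
  Unique S × length S ≡ b × IsResolvingSet G S ×
  (∀ (T : List (V G)) → Unique T → IsResolvingSet G T → b ≤ length T)

basisS : (n : ℕ) → List (ℤ × Fin n)
basisS zero = []
basisS (suc k) = map (λ i → (+ toℕ i , inject₁ i)) (allFin k)

module Submission where

-- 1. Distances.  A 1-Lipschitz potential that vanishes at v bounds the length
--    of every walk to v; if some walk attains it, it is the distance.  Applied
--    to the product, d((i,a),(j,b)) = |i - j| + δ(a,b), where δ is the
--    discrete metric on the columns of Kₙ.
-- 2. S resolves.  If u = (i,a) and v = (j,c) are equidistant from all of S,
--    pick a basis column avoiding a and c (possible as n ≥ 4): there the
--    column terms agree, so |i| and |j| have equal parity.  Parity then forces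
--    δ(a,k) = δ(c,k) for every basis column k, hence a = c, and the distances
--    to (0,0) and (1,1) give i = j.
-- 3. Lower bound.  (i,a) and (i,b) with a ≠ b are resolved only by vertices
--    in column a or b, so the columns of a resolving set meet every pair of
--    distinct columns; such a list misses at most one column, hence has at
--    least n - 1 entries (an injection argument on Fin).

open import Defs
open import Data.Nat using (ℕ; zero; suc; _+_; _≤_; _∸_; z≤n; s≤s; _≟_; parity)
open import Data.Nat.Properties
  using (≤-refl; ≤-trans; ≤-reflexive; ≤-antisym; +-suc; +-identityʳ;
         +-monoʳ-≤; +-monoˡ-≤; +-cancelʳ-≡; suc-injective; m≢1+n+m)
open import Data.Integer using (ℤ; -[1+_]; _-_; ∣_∣; -_; _⊖_; 1ℤ; -1ℤ)
  renaming (_+_ to _+ℤ_; +_ to pos)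
import Data.Integer.Properties as ℤ
open import Data.Integer.Tactic.RingSolver using (solve-∀)
open import Data.Parity using () renaming (_+_ to _+ℙ_)
import Data.Parity.Properties as ℙ
open import Data.Fin using (Fin; toℕ; inject₁; lower₁; punchIn)
  renaming (zero to fzero; suc to fsuc; _≟_ to _≟ᶠ_)
open import Data.Fin.Properties
  using (toℕ-injective; inject₁-injective; inject₁-lower₁; punchIn-injective;
         punchInᵢ≢i; injective⇒≤; all?; ¬∀⟶∃¬)
open import Data.List using (List; map; length; allFin; lookup)
open import Data.List.Properties using (length-map; length-tabulate)
open import Data.List.Membership.Propositional using (_∈_; find)
open import Data.List.Membership.Propositional.Properties using (∈-map⁺; ∈-allFin)
open import Data.List.Relation.Unary.Any using (any?; index)
open import Data.List.Relation.Unary.Any.Properties using (lookup-index)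
open import Data.List.Relation.Unary.All using () renaming (lookup to All-lookup)
open import Data.List.Relation.Unary.All.Properties using (¬Any⇒All¬)
open import Data.List.Relation.Unary.Unique.Propositional using (Unique)
open import Data.List.Relation.Unary.Unique.Propositional.Properties using (map⁺; allFin⁺)
open import Data.Sum using (_⊎_; inj₁; inj₂; fromInj₂)
open import Data.Product using (_×_; _,_; ∃; proj₁; proj₂)
open import Data.Empty using (⊥-elim)
open import Function using (_∘_)
open import Relation.Nullary using (yes; no; ¬?; contradiction)
open import Relation.Nullary.Decidable using (decidable-stable)
open import Relation.Binary.PropositionalEquality
  using (_≡_; _≢_; refl; sym; trans; cong; cong₂; subst; subst₂; module ≡-Reasoning)

-- Walks and distances in an arbitrary graph

Lipschitz : (G : Graph) → (V G → ℕ) → Set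
Lipschitz G f = ∀ {u w} → Adj G u w → f u ≤ suc (f w)

walk-length-bound : ∀ {G f} → Lipschitz G f → ∀ {u v k} → Walk G u v k → f u ≤ k + f v
walk-length-bound lip nil = ≤-refl
walk-length-bound lip (step adj w) = ≤-trans (lip adj) (s≤s (walk-length-bound lip w))

distance-by-potential : ∀ {G} (f : V G → ℕ) → Lipschitz G f → ∀ {u v} →
                        f v ≡ 0 → Walk G u v (f u) → IsDist G u v (f u)
distance-by-potential {G} f lip {u} {v} fv≡0 w = w , minimal
  where
  minimal : ∀ m → Walk G u v m → f u ≤ m
  minimal m w′ = subst (f u ≤_) (trans (cong (m +_) fv≡0) (+-identityʳ m))
                   (walk-length-bound lip w′)

isDist-unique : ∀ {G u v k l} → IsDist G u v k → IsDist G u v l → k ≡ l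
isDist-unique (wk , k-min) (wl , l-min) = ≤-antisym (k-min _ wl) (l-min _ wk)

append : ∀ {G u v w k l} → Walk G u v k → Walk G v w l → Walk G u w (k + l)
append nil q = q
append (step adj p) q = step adj (append p q)

-- Cartesian products

□-lipschitz : ∀ {G H f g} → Lipschitz G f → Lipschitz H g →
              Lipschitz (G □ H) (λ u → f (proj₁ u) + g (proj₂ u))
□-lipschitz {f = f} {g} _ lipH {a , x} (inj₁ (refl , adj)) =
  ≤-trans (+-monoʳ-≤ (f a) (lipH adj)) (≤-reflexive (+-suc (f a) _))
□-lipschitz {f = f} {g} lipG _ {a , x} (inj₂ (refl , adj)) =
  +-monoˡ-≤ (g x) (lipG adj)

lift-left : ∀ {G H a b k} {x : V H} → Walk G a b k → Walk (G □ H) (a , x) (b , x) k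
lift-left nil = nil
lift-left (step adj w) = step (inj₂ (refl , adj)) (lift-left w)

lift-right : ∀ {G H x y k} {a : V G} → Walk H x y k → Walk (G □ H) (a , x) (a , y) k
lift-right nil = nil
lift-right (step adj w) = step (inj₁ (refl , adj)) (lift-right w)

-- The two-way infinite path

∣i-i∣≡0 : ∀ i → ∣ i - i ∣ ≡ 0
∣i-i∣≡0 i = cong ∣_∣ (ℤ.+-inverseʳ i)

path-lipschitz : ∀ j → Lipschitz P2∞ (λ i → ∣ i - j ∣)
path-lipschitz j {i} {i′} adj = begin
  ∣ i - j ∣                     ≡⟨ cong ∣_∣ (split i i′ j) ⟩
  ∣ (i - i′) +ℤ (i′ - j) ∣      ≤⟨ ℤ.∣i+j∣≤∣i∣+∣j∣ (i - i′) (i′ - j) ⟩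
  ∣ i - i′ ∣ + ∣ i′ - j ∣       ≡⟨ cong (_+ ∣ i′ - j ∣) adj ⟩
  suc ∣ i′ - j ∣                ∎
  where
  open Data.Nat.Properties.≤-Reasoning
  split : ∀ i i′ j → i - j ≡ (i - i′) +ℤ (i′ - j)
  split = solve-∀

unit-step : ∀ i s → ∣ s ∣ ≡ 1 → Adj P2∞ i (i +ℤ s)
unit-step i s ∣s∣≡1 = trans (cong ∣_∣ (i-[i+s]≡-s i s)) (trans (ℤ.∣-i∣≡∣i∣ s) ∣s∣≡1)
  where
  i-[i+s]≡-s : ∀ i s → i - (i +ℤ s) ≡ - s
  i-[i+s]≡-s = solve-∀

walk-by : ∀ i d → Walk P2∞ i (i +ℤ d) ∣ d ∣
walk-by i (pos zero) = subst (λ t → Walk P2∞ i t 0) (sym (ℤ.+-identityʳ i)) nil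
walk-by i (pos (suc k)) =
  step (unit-step i 1ℤ refl)
       (subst (λ t → Walk P2∞ _ t k) (ℤ.+-assoc i 1ℤ (pos k)) (walk-by (i +ℤ 1ℤ) (pos k)))
walk-by i -[1+ zero ] = step (unit-step i -1ℤ refl) nil
walk-by i -[1+ suc k ] =
  step (unit-step i -1ℤ refl)
       (subst (λ t → Walk P2∞ _ t (suc k)) (ℤ.+-assoc i -1ℤ -[1+ k ]) (walk-by (i +ℤ -1ℤ) -[1+ k ]))

path-walk : ∀ i j → Walk P2∞ i j ∣ i - j ∣
path-walk i j = subst₂ (Walk P2∞ i) (i+[j-i]≡j i j) (ℤ.∣i-j∣≡∣j-i∣ j i) (walk-by i (j - i))
  where
  i+[j-i]≡j : ∀ i j → i +ℤ (j - i) ≡ j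
  i+[j-i]≡j = solve-∀

-- The complete graph: the discrete metric δ

δ : ∀ {n} → Fin n → Fin n → ℕ
δ a b with a ≟ᶠ b
... | yes _ = 0
... | no _ = 1

δ-refl : ∀ {n} (a : Fin n) → δ a a ≡ 0
δ-refl a with a ≟ᶠ a
... | yes _ = refl
... | no a≢a = contradiction refl a≢a

δ-≢ : ∀ {n} {a b : Fin n} → a ≢ b → δ a b ≡ 1
δ-≢ {a = a} {b} a≢b with a ≟ᶠ b
... | yes a≡b = contradiction a≡b a≢b
... | no _ = refl

δ≡0⇒≡ : ∀ {n} {a b : Fin n} → δ a b ≡ 0 → a ≡ b
δ≡0⇒≡ {a = a} {b} δ≡0 with a ≟ᶠ b
... | yes a≡b = a≡b
δ≡0⇒≡ () | no _

δ≤1 : ∀ {n} (a b : Fin n) → δ a b ≤ 1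
δ≤1 a b with a ≟ᶠ b
... | yes _ = z≤n
... | no _ = s≤s z≤n

complete-lipschitz : ∀ {n} (b : Fin n) → Lipschitz (K n) (λ a → δ a b)
complete-lipschitz b {a} _ = ≤-trans (δ≤1 a b) (s≤s z≤n)

complete-walk : ∀ {n} (a b : Fin n) → Walk (K n) a b (δ a b)
complete-walk a b with a ≟ᶠ b
... | yes refl = nil
... | no a≢b = step a≢b nil

-- Distances in the grid P₂∞ □ Kₙ

Grid : ℕ → Graph
Grid n = P2∞ □ K n

gridDist : ∀ {n} → ℤ × Fin n → ℤ × Fin n → ℕ
gridDist (i , a) (j , b) = ∣ i - j ∣ + δ a b

gridDist-isDist : ∀ {n} (u v : ℤ × Fin n) → IsDist (Grid n) u v (gridDist u v)
gridDist-isDist {n} (i , a) (j , b) =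
  distance-by-potential {Grid n} (λ u → gridDist u (j , b))
    (□-lipschitz {P2∞} {K n} (λ {i} {i′} → path-lipschitz j {i} {i′}) (complete-lipschitz b))
    {i , a} {j , b}
    (cong₂ _+_ (∣i-i∣≡0 j) (δ-refl b))
    (append (lift-left (path-walk i j)) (lift-right (complete-walk a b)))

-- Parity facts

parity-∣⊖∣ : ∀ m n → parity ∣ m ⊖ n ∣ ≡ parity m +ℙ parity n
parity-∣⊖∣ m zero = sym (ℙ.+-identityʳ (parity m))
parity-∣⊖∣ zero (suc n) = refl
parity-∣⊖∣ (suc m) (suc n) = begin
  parity ∣ suc m ⊖ suc n ∣           ≡⟨ cong (parity ∘ ∣_∣) (ℤ.[1+m]⊖[1+n]≡m⊖n m n) ⟩
  parity ∣ m ⊖ n ∣                   ≡⟨ parity-∣⊖∣ m n ⟩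
  parity m +ℙ parity n               ≡⟨ ℙ.+-homo-+ m n ⟨
  parity (suc (suc (m + n)))         ≡⟨ cong (parity ∘ suc) (+-suc m n) ⟨
  parity (suc m + suc n)             ≡⟨ ℙ.+-homo-+ (suc m) (suc n) ⟩
  parity (suc m) +ℙ parity (suc n)   ∎
  where open ≡-Reasoning

parity-∣i-k∣ : ∀ i k → parity ∣ i - pos k ∣ ≡ parity ∣ i ∣ +ℙ parity k
parity-∣i-k∣ (pos m) k = trans (cong (parity ∘ ∣_∣) (ℤ.[+m]-[+n]≡m⊖n m k)) (parity-∣⊖∣ m k)
parity-∣i-k∣ -[1+ m ] k = begin
  parity ∣ -[1+ m ] - pos k ∣      ≡⟨ cong (parity ∘ ∣_∣) (ℤ.neg-minus-pos m k) ⟩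
  parity (suc (k + m))           ≡⟨ cong parity (+-suc k m) ⟨
  parity (k + suc m)             ≡⟨ ℙ.+-homo-+ k (suc m) ⟩
  parity k +ℙ parity (suc m)     ≡⟨ ℙ.+-comm (parity k) (parity (suc m)) ⟩
  parity (suc m) +ℙ parity k     ∎
  where open ≡-Reasoning

bit-by-parity : ∀ {x y s t} → s ≤ 1 → t ≤ 1 → parity x ≡ parity y → x + s ≡ y + t → s ≡ t
bit-by-parity {x} {y} {s} {t} s≤1 t≤1 px≡py sum≡ = bits s≤1 t≤1 parity-s≡t
  where
  parity-s≡t : parity s ≡ parity t
  parity-s≡t = ℙ.+-cancelˡ-≡ (parity y) (parity s) (parity t) (begin
    parity y +ℙ parity s   ≡⟨ cong (_+ℙ parity s) px≡py ⟨
    parity x +ℙ parity s   ≡⟨ ℙ.+-homo-+ x s ⟨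
    parity (x + s)         ≡⟨ cong parity sum≡ ⟩
    parity (y + t)         ≡⟨ ℙ.+-homo-+ y t ⟩
    parity y +ℙ parity t   ∎)
    where open ≡-Reasoning
  bits : ∀ {s t} → s ≤ 1 → t ≤ 1 → parity s ≡ parity t → s ≡ t
  bits z≤n z≤n _ = refl
  bits (s≤s z≤n) (s≤s z≤n) _ = refl
  bits z≤n (s≤s z≤n) ()
  bits (s≤s z≤n) z≤n ()

-- The diagonal resolves the grid

diag : ∀ {m} → Fin m → ℤ × Fin (suc m)
diag f = (pos (toℕ f) , inject₁ f)

-- One of the first three columns differs from both a and c; this is where n ≥ 4 is used.
avoid-two : ∀ {r} (a c : Fin (4 + r)) → ∃ λ (f : Fin (3 + r)) → a ≢ inject₁ f × c ≢ inject₁ f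
avoid-two fzero fzero = fsuc fzero , (λ ()) , (λ ())
avoid-two fzero (fsuc fzero) = fsuc (fsuc fzero) , (λ ()) , (λ ())
avoid-two fzero (fsuc (fsuc _)) = fsuc fzero , (λ ()) , (λ ())
avoid-two (fsuc fzero) fzero = fsuc (fsuc fzero) , (λ ()) , (λ ())
avoid-two (fsuc fzero) (fsuc fzero) = fzero , (λ ()) , (λ ())
avoid-two (fsuc fzero) (fsuc (fsuc _)) = fzero , (λ ()) , (λ ())
avoid-two (fsuc (fsuc _)) fzero = fsuc fzero , (λ ()) , (λ ())
avoid-two (fsuc (fsuc _)) (fsuc _) = fzero , (λ ()) , (λ ())

-- A column other than the last is determined by its discrete-metric profile
-- on the first m columns: it is the unique column at δ-distance 0.
inner-column-determined : ∀ {m} {a c : Fin (suc m)} → m ≢ toℕ a →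
                          (∀ f → δ a (inject₁ f) ≡ δ c (inject₁ f)) → a ≡ c
inner-column-determined {a = a} {c} a-inner same = sym (δ≡0⇒≡ (begin
  δ c a                   ≡⟨ cong (δ c) (inject₁-lower₁ a a-inner) ⟨
  δ c (inject₁ a′)        ≡⟨ same a′ ⟨
  δ a (inject₁ a′)        ≡⟨ cong (δ a) (inject₁-lower₁ a a-inner) ⟩
  δ a a                   ≡⟨ δ-refl a ⟩
  0                       ∎))
  where
  open ≡-Reasoning
  a′ = lower₁ a a-inner

columns-determined : ∀ {m} (a c : Fin (suc m)) →
                     (∀ f → δ a (inject₁ f) ≡ δ c (inject₁ f)) → a ≡ c
columns-determined {m} a c same with m ≟ toℕ a | m ≟ toℕ c
... | no a-inner | _ = inner-column-determined a-inner same
... | yes _ | no c-inner = sym (inner-column-determined c-inner (sym ∘ same))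
... | yes a-last | yes c-last = toℕ-injective (trans (sym a-last) c-last)

row-determined : ∀ i j → ∣ i ∣ ≡ ∣ j ∣ → ∣ i - 1ℤ ∣ ≡ ∣ j - 1ℤ ∣ → i ≡ j
row-determined (pos p) (pos q) e₀ _ = cong pos e₀
row-determined -[1+ p ] -[1+ q ] e₀ _ = cong -[1+_] (suc-injective e₀)
row-determined (pos (suc p)) -[1+ q ] e₀ e₁ = ⊥-elim (m≢1+n+m q
  (trans (sym (suc-injective e₀)) (trans e₁ (cong (suc ∘ suc) (+-identityʳ q)))))
row-determined -[1+ q ] (pos (suc p)) e₀ e₁ = ⊥-elim (m≢1+n+m q
  (trans (suc-injective e₀) (trans (sym e₁) (cong (suc ∘ suc) (+-identityʳ q)))))

diagonal-separates : ∀ {r} (u v : ℤ × Fin (4 + r)) →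
                     (∀ f → gridDist u (diag f) ≡ gridDist v (diag f)) → u ≡ v
diagonal-separates {r} (i , a) (j , c) equidistant with avoid-two a c
... | f₀ , a≢f₀ , c≢f₀ = cong₂ _,_ same-row same-column
  where
  row : ℤ → Fin (3 + r) → ℕ
  row x f = ∣ x - pos (toℕ f) ∣

  same-parity : parity ∣ i ∣ ≡ parity ∣ j ∣
  same-parity = ℙ.+-cancelʳ-≡ (parity (toℕ f₀)) (parity ∣ i ∣) (parity ∣ j ∣) (begin
    parity ∣ i ∣ +ℙ parity (toℕ f₀)   ≡⟨ parity-∣i-k∣ i (toℕ f₀) ⟨
    parity (row i f₀)                 ≡⟨ cong parity row-f₀ ⟩
    parity (row j f₀)                 ≡⟨ parity-∣i-k∣ j (toℕ f₀) ⟩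
    parity ∣ j ∣ +ℙ parity (toℕ f₀)   ∎)
    where
    open ≡-Reasoning
    row-f₀ : row i f₀ ≡ row j f₀
    row-f₀ = +-cancelʳ-≡ 1 _ _ (subst₂ (λ s t → row i f₀ + s ≡ row j f₀ + t)
      (δ-≢ a≢f₀) (δ-≢ c≢f₀) (equidistant f₀))

  same-δ : ∀ f → δ a (inject₁ f) ≡ δ c (inject₁ f)
  same-δ f = bit-by-parity (δ≤1 a _) (δ≤1 c _)
    (trans (parity-∣i-k∣ i (toℕ f))
      (trans (cong (_+ℙ parity (toℕ f)) same-parity) (sym (parity-∣i-k∣ j (toℕ f)))))
    (equidistant f)

  same-column : a ≡ c
  same-column = columns-determined a c same-δ

  same-row-dist : ∀ f → row i f ≡ row j f
  same-row-dist f = +-cancelʳ-≡ (δ c (inject₁ f)) _ _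
    (subst (λ s → row i f + s ≡ row j f + δ c (inject₁ f)) (same-δ f) (equidistant f))

  x-0≡x : ∀ x → x - pos 0 ≡ x
  x-0≡x = ℤ.+-identityʳ

  same-row : i ≡ j
  same-row = row-determined i j
    (subst₂ (λ x y → ∣ x ∣ ≡ ∣ y ∣) (x-0≡x i) (x-0≡x j) (same-row-dist fzero))
    (same-row-dist (fsuc fzero))

resolving-by-separation : ∀ {G} (d : V G → V G → ℕ) → (∀ u v → IsDist G u v (d u v)) →
                          (S : List (V G)) →
                          (∀ u v → (∀ {x} → x ∈ S → d u x ≡ d v x) → u ≡ v) →
                          IsResolvingSet G S
resolving-by-separation d isDist S separates u v u≢v
  with any? (λ x → ¬? (d u x ≟ d v x)) S
... | yes resolver = let x , x∈S , d≢ = find resolver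
                     in x , x∈S , d u x , d v x , isDist u x , isDist v x , d≢
... | no no-resolver = ⊥-elim (u≢v (separates u v (λ {x} x∈S →
        decidable-stable (d u x ≟ d v x) (All-lookup (¬Any⇒All¬ S no-resolver) x∈S))))

diagonal-resolving : ∀ r → IsResolvingSet (Grid (4 + r)) (basisS (4 + r))
diagonal-resolving r = resolving-by-separation gridDist gridDist-isDist (basisS (4 + r))
  (λ u v equidistant → diagonal-separates u v (equidistant ∘ ∈-map⁺ diag ∘ ∈-allFin))

-- Every resolving set has at least n - 1 vertices

row-pair-resolvers : ∀ {n} i {a b : Fin n} (x : ℤ × Fin n) →
                     Resolves (Grid n) x (i , a) (i , b) → proj₂ x ≡ a ⊎ proj₂ x ≡ b
row-pair-resolvers i {a} {b} (j , c) (k₁ , k₂ , d₁ , d₂ , k₁≢k₂) with c ≟ᶠ a | c ≟ᶠ b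
... | yes c≡a | _ = inj₁ c≡a
... | no _ | yes c≡b = inj₂ c≡b
... | no c≢a | no c≢b = contradiction (begin
  k₁                   ≡⟨ isDist-unique d₁ (gridDist-isDist (i , a) (j , c)) ⟩
  ∣ i - j ∣ + δ a c    ≡⟨ cong (∣ i - j ∣ +_) (trans (δ-≢ (c≢a ∘ sym)) (sym (δ-≢ (c≢b ∘ sym)))) ⟩
  ∣ i - j ∣ + δ b c    ≡⟨ isDist-unique (gridDist-isDist (i , b) (j , c)) d₂ ⟩
  k₂                   ∎) k₁≢k₂
  where open ≡-Reasoning

all-but-one : ∀ {m} (L : List (Fin (suc m))) (a : Fin (suc m)) →
              (∀ b → b ≢ a → b ∈ L) → m ≤ length L
all-but-one {m} L a covers = injective⇒≤ position-injective
  where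
  position : Fin m → Fin (length L)
  position b = index (covers (punchIn a b) (punchInᵢ≢i a b))
  position-injective : ∀ {x y} → position x ≡ position y → x ≡ y
  position-injective {x} {y} eq = punchIn-injective a x y
    (trans (lookup-index (covers (punchIn a x) (punchInᵢ≢i a x)))
      (trans (cong (lookup L) eq) (sym (lookup-index (covers (punchIn a y) (punchInᵢ≢i a y))))))

pair-cover-size : ∀ {m} (L : List (Fin (suc m))) →
                  (∀ a b → a ≢ b → a ∈ L ⊎ b ∈ L) → m ≤ length L
pair-cover-size {m} L meets with all? (λ a → any? (a ≟ᶠ_) L)
... | yes all-in = all-but-one L fzero (λ b _ → all-in b)
... | no not-all-in with ¬∀⟶∃¬ (suc m) (_∈ L) (λ a → any? (a ≟ᶠ_) L) not-all-in
...   | a , a∉L = all-but-one L a (λ b b≢a → fromInj₂ (⊥-elim ∘ a∉L) (meets a b (b≢a ∘ sym)))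

resolving-set-size : ∀ {m} (T : List (ℤ × Fin (suc m))) →
                     IsResolvingSet (Grid (suc m)) T → m ≤ length T
resolving-set-size T resolving =
  ≤-trans (pair-cover-size (map proj₂ T) columns-meet) (≤-reflexive (length-map proj₂ T))
  where
  columns-meet : ∀ a b → a ≢ b → a ∈ map proj₂ T ⊎ b ∈ map proj₂ T
  columns-meet a b a≢b with resolving (pos 0 , a) (pos 0 , b) (a≢b ∘ cong proj₂)
  ... | x , x∈T , resolves with row-pair-resolvers (pos 0) x resolves
  ...   | inj₁ refl = inj₁ (∈-map⁺ proj₂ x∈T)
  ...   | inj₂ refl = inj₂ (∈-map⁺ proj₂ x∈T)

diagonal-unique : ∀ m → Unique (basisS (suc m))
diagonal-unique m = map⁺ (inject₁-injective ∘ cong proj₂) (allFin⁺ m)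

diagonal-length : ∀ m → length (basisS (suc m)) ≡ m
diagonal-length m = trans (length-map diag (allFin m)) (length-tabulate (λ f → f))

proposition9 : (n : ℕ) → 4 ≤ n → IsMetricBasisOfSize (P2∞ □ K n) (basisS n) (n ∸ 1)
proposition9 _ (s≤s (s≤s (s≤s (s≤s (z≤n {r}))))) =
  diagonal-unique (3 + r) ,
  diagonal-length (3 + r) ,
  diagonal-resolving r ,
  λ T _ → resolving-set-size T
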